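{- Let $1\leq k<\omega$ and let $A\subseteq(\omega^\omega)^k$ be $\sigma$-projective. Then for every $\sigma$-projective code $[A]$ for $A$ in which no complements appear, the decoding game for $A$ with respect to $[A]$ is a simple clopen game of length $\omega^2$.
   Context: The $\sigma$-projective sets form the smallest pointclass (of subsets of the spaces $(\omega^\omega)^k$ with the product topology of discrete $\omega$) containing the open sets and closed under complements, countable unions, and projections. Fix an enumeration $\{A_{m+1}:m\in\omega\}$ of all basic open and basic closed sets in each $(\omega^\omega)^k$. $\sigma$-projective codes: if $A=A_m$ is basic open or basic closed, $[A]=\langle m\rangle$; if $A=\bigcup_iA_i$, $[A]=\langle[A_0],[A_1],\dots\rangle$; if $A=\bigcap_iA_i$, $[A]=\langle0,[A_0],[A_1],\dots\rangle$; if $A=(\omega^\omega)^k\setminus B$, $[A]=\langle1,[B]\rangle$ (this is what "complements appear" refers to); if $A=p[B]=\{x:\exists y\,(x,y)\in B\}$, $[A]=\langle2,[B]\rangle$; if $A=u[B]=\{x:\forall y\,(x,y)\in B\}$, $[A]=\langle3,[B]\rangle$. The decoding game for $A\subseteq(\omega^\omega)^k$ with respect to $[A]$ is a game of length $\omega^2$: first I and II alternate for $\omega\cdot k$ moves producing reals $x_1,\dots,x_k$; then, with current tuple $\vec x$ (initially $(x_1,\dots,x_k)$), play proceeds recursively: if the code is $\langle m\rangle$, the game ends and I wins iff $\vec x\in A_m$; for $\bigcup_iA_i$, Player I plays $j\in\omega$ and play continues (without $j$) by the rules for $[A_j]$; for $\bigcap_iA_i$, Player II plays $j$ and play continues by the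 rules for $[A_j]$; for a complement of $B$, play continues by the rules for $[B]$ with roles reversed; for $p[B]$, Player I plays a real $y$ in $\omega$ moves (Player II's moves irrelevant) and play continues with $(\vec x,y)$ by the rules for $[B]$; for $u[B]$, Player II plays $y$ similarly. Identify $\omega^{\omega\cdot n}$ with $(\omega^\omega)^n$ and $A\subseteq\omega^{\omega\cdot n}$ with $\{x\in\omega^{\omega^2}:x\restriction\omega\cdot n\in A\}$. Simple clopen games of length $\omega^2$ are generated as follows: (i) for each $n$, a game decided after $\omega\cdot n$ moves whose payoff restricted to sequences of length $\omega\cdot n$ is clopen is simple clopen; (ii) if $n\in\omega$ and $G_i$ ($i\in\omega$) are simple clopen, then the game in which I and II alternate for $\omega\cdot n$ moves, then Player I plays $i\in\omega$, then play continues by the rules of $G_i$ (keeping the first $\omega\cdot n$ moves, not $i$) is simple clopen; (iii) the same with Player II choosing $i$. -}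

module Defs where

open import Data.Nat using (ℕ; zero; suc; _+_; _<_)
open import Data.Nat.Properties using (+-identityʳ)
open import Data.Fin using (Fin; zero; suc; cast; inject₁; fromℕ)
open import Data.Bool using (Bool; true; false; not)
open import Data.List using (List; []; _∷_)
open import Data.Product using (Σ; _×_; ∃)
open import Data.Unit using (⊤)
open import Relation.Nullary using (¬_)
open import Relation.Binary.PropositionalEquality using (_≡_; sym)
open import Function using (_∘_; id)

-- a real: an element of ω^ω
ℝ : Set
ℝ = ℕ → ℕ

-- an element of (ω^ω)^n (equivalently of ω^(ω·n))
Tuple : ℕ → Set
Tuple n = Fin n → ℝ

snoc : ∀ {n} → Tuple n → ℝ → Tuple (suc n)
snoc {zero}  x y zero    = y
snoc {suc n} x y zero    = x zero
snoc {suc n} x y (suc i) = snoc (x ∘ suc) y i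

initT : ∀ {n} → Tuple (suc n) → Tuple n
initT x = x ∘ inject₁

lastT : ∀ {n} → Tuple (suc n) → ℝ
lastT {n} x = x (fromℕ n)

-- moves of player I (even positions) and of player II (odd positions)
-- in a block of ω alternating moves
movesI : ℝ → ℝ
movesI z t = z (t + t)

movesII : ℝ → ℝ
movesII z t = z (suc (t + t))

Agree : ∀ {n} → ℕ → Tuple n → Tuple n → Set
Agree l x y = ∀ i t → t < l → x i t ≡ y i t

IsOpen : ∀ {n} → (Tuple n → Set) → Set
IsOpen P = ∀ x → P x → Σ ℕ λ l → ∀ y → Agree l x y → P y

IsClopen : ∀ {n} → (Tuple n → Set) → Set
IsClopen P = IsOpen P × IsOpen (λ x → ¬ P x)

Prefix : List ℕ → ℝ → Set
Prefix []      z = ⊤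
Prefix (a ∷ s) z = (z 0 ≡ a) × Prefix s (z ∘ suc)

record BasicSet (k : ℕ) : Set where
  constructor basicSet
  field
    isOpen : Bool
    stems  : Fin k → List ℕ

⟦_⟧b : ∀ {k} → BasicSet k → Tuple k → Set
⟦ basicSet true  s ⟧b x = ∀ i → Prefix (s i) (x i)
⟦ basicSet false s ⟧b x = ¬ (∀ i → Prefix (s i) (x i))

data Code (k : ℕ) : Set where
  basic : BasicSet k → Code k
  union : (ℕ → Code k) → Code k
  inter : (ℕ → Code k) → Code k
  compl : Code k → Code k
  proj  : Code (suc k) → Code k
  univ  : Code (suc k) → Code k

⟦_⟧ : ∀ {k} → Code k → Tuple k → Set
⟦ basic b  ⟧ x = ⟦ b ⟧b x
⟦ union cs ⟧ x = Σ ℕ λ j → ⟦ cs j ⟧ x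
⟦ inter cs ⟧ x = ∀ j → ⟦ cs j ⟧ x
⟦ compl c  ⟧ x = ¬ ⟦ c ⟧ x
⟦ proj c   ⟧ x = Σ ℝ λ y → ⟦ c ⟧ (snoc x y)
⟦ univ c   ⟧ x = ∀ y → ⟦ c ⟧ (snoc x y)

data NoCompl : ∀ {k} → Code k → Set where
  nc-basic : ∀ {k} (b : BasicSet k) → NoCompl (basic b)
  nc-union : ∀ {k} (cs : ℕ → Code k) → (∀ j → NoCompl (cs j)) → NoCompl (union cs)
  nc-inter : ∀ {k} (cs : ℕ → Code k) → (∀ j → NoCompl (cs j)) → NoCompl (inter cs)
  nc-proj  : ∀ {k} (c : Code (suc k)) → NoCompl c → NoCompl (proj c)
  nc-univ  : ∀ {k} (c : Code (suc k)) → NoCompl c → NoCompl (univ c)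

-- A  Game n  is the rule of the remainder of a game in which ω·n moves
-- (i.e. n reals, each the interleaving of I's and II's moves) have
-- been played so far and recorded.

data Game (n : ℕ) : Set₁ where
  -- game is decided: I wins iff the recorded play satisfies P
  end    : (Tuple n → Set) → Game n
  -- I and II alternate for ω moves (I first); the resulting real is recorded
  block  : Game (suc n) → Game n
  -- Player I plays a natural number i (not recorded), play continues by G i
  moveI  : (ℕ → Game n) → Game n
  -- Player II plays a natural number i (not recorded), play continues by G i
  moveII : (ℕ → Game n) → Game n

blocks : ∀ {m} (j : ℕ) → Game (j + m) → Game m
blocks zero    G = G
blocks (suc j) G = blocks j (block G)

data SimpleClopen : ∀ {m} → Game m → Set₁ where
  sc-clopen : ∀ {m} (j : ℕ) (P : Tuple (j + m) → Set) → IsClopen P →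
              SimpleClopen (blocks {m} j (end P))
  sc-I  : ∀ {m} (j : ℕ) (G : ℕ → Game (j + m)) → (∀ i → SimpleClopen (G i)) →
          SimpleClopen (blocks {m} j (moveI G))
  sc-II : ∀ {m} (j : ℕ) (G : ℕ → Game (j + m)) → (∀ i → SimpleClopen (G i)) →
          SimpleClopen (blocks {m} j (moveII G))

-- The decoding game.
-- decode flipped c e : the rules for code c at stage n, where
--   flipped = true  means the roles of I and II are currently reversed,
--   e extracts the current tuple (x⃗) from the recorded play.

decode : ∀ {k n} → Bool → Code k → (Tuple n → Tuple k) → Game n
decode false (basic b)  e = end (λ r → ⟦ b ⟧b (e r))
decode true  (basic b)  e = end (λ r → ¬ ⟦ b ⟧b (e r))
decode false (union cs) e = moveI  (λ j → decode false (cs j) e)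
decode true  (union cs) e = moveII (λ j → decode true  (cs j) e)
decode false (inter cs) e = moveII (λ j → decode false (cs j) e)
decode true  (inter cs) e = moveI  (λ j → decode true  (cs j) e)
decode f     (compl c)  e = decode (not f) c e
decode false (proj c)   e = block (decode false c (λ r → snoc (e (initT r)) (movesI  (lastT r))))
decode true  (proj c)   e = block (decode true  c (λ r → snoc (e (initT r)) (movesII (lastT r))))
decode false (univ c)   e = block (decode false c (λ r → snoc (e (initT r)) (movesII (lastT r))))
decode true  (univ c)   e = block (decode true  c (λ r → snoc (e (initT r)) (movesI  (lastT r))))

decodingGame : ∀ {k} → Code k → Game 0
decodingGame {k} c =
  blocks {0} k (decode false c (λ r i → r (cast (sym (+-identityʳ k)) i)))

{-# OPTIONS --safe #-}
module Submission where

open import Defs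
open import Data.Nat using (ℕ; _≤_; zero; suc; _+_; _<_; z≤n; s≤s)
open import Data.Nat.Properties
  using (+-suc; +-identityʳ; <-≤-trans; m≤m+n; m≤n+m; ≤-trans; +-mono-<)
open import Function.Bundles using (_⇔_)
open import Data.Fin using (Fin; zero; suc; cast; inject₁; fromℕ)
open import Data.Bool using (true; false)
open import Data.List using (List; []; _∷_; length)
open import Data.Product using (Σ; _,_)
open import Level using (Level)
open import Relation.Nullary using (¬_)
open import Relation.Binary.PropositionalEquality
  using (_≡_; refl; sym; trans; cong; subst)
open import Relation.Binary.PropositionalEquality.Properties
  using (subst-application; subst-application′)
open import Function using (_∘_)

-- Without complements the decoding game never reverses roles, so it is built from
-- three kinds of steps: a union or intersection is a move of I or of II on a natural
-- number, a projection or universal quantifier is one more block of ω moves, and a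
-- basic set is a payoff. Simple clopen games are closed under prepending a block,
-- and a basic set is clopen in the recorded play because the current tuple x⃗ is a
-- continuous function of the play: each coordinate is x_i itself or the moves of one
-- player in one block.

private
  variable
    a b ℓ : Level

subst-preserves : {A : Set a} {F : A → Set b} (P : ∀ {x} → F x → Set ℓ) {x y : A}
  (x≡y : x ≡ y) {u : F x} → P u → P (subst F x≡y u)
subst-preserves P refl pu = pu

block-blocks : ∀ j m (H : Game (j + suc m)) →
  block (blocks {suc m} j H) ≡ blocks {m} (suc j) (subst Game (+-suc j m) H)
block-blocks zero    m H = refl
block-blocks (suc j) m H =
  trans (block-blocks j m (block H))
        (cong (blocks {m} j ∘ block) (subst-application Game (λ _ → block) (+-suc j m)))

block-blocks-shape : ∀ j m {T : ℕ → Set₁} (C : ∀ {n} → T n → Game n)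
  (u : T (j + suc m)) →
  block (blocks {suc m} j (C u)) ≡ blocks {m} (suc j) (C (subst T (+-suc j m) u))
block-blocks-shape j m {T} C u =
  trans (block-blocks j m (C u))
        (cong (blocks {m} (suc j)) (subst-application′ T (λ _ → C) (+-suc j m)))

SimpleClopen-subst-family : ∀ {m n} (m≡n : m ≡ n) {G : ℕ → Game m} →
  (∀ i → SimpleClopen (G i)) → ∀ i → SimpleClopen (subst (λ l → ℕ → Game l) m≡n G i)
SimpleClopen-subst-family =
  subst-preserves {F = λ l → ℕ → Game l} (λ G′ → ∀ i → SimpleClopen (G′ i))

SimpleClopen-block : ∀ {m} {G : Game (suc m)} → SimpleClopen G →
  SimpleClopen {m} (block G)
SimpleClopen-block {m} (sc-clopen j P clopen) =
  subst SimpleClopen (sym (block-blocks-shape j m end P))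
    (sc-clopen (suc j) _ (subst-preserves IsClopen (+-suc j m) clopen))
SimpleClopen-block {m} (sc-I j G sc) =
  subst SimpleClopen (sym (block-blocks-shape j m moveI G))
    (sc-I (suc j) _ (SimpleClopen-subst-family (+-suc j m) sc))
SimpleClopen-block {m} (sc-II j G sc) =
  subst SimpleClopen (sym (block-blocks-shape j m moveII G))
    (sc-II (suc j) _ (SimpleClopen-subst-family (+-suc j m) sc))

SimpleClopen-blocks : ∀ j {m} {G : Game (j + m)} → SimpleClopen G →
  SimpleClopen (blocks {m} j G)
SimpleClopen-blocks zero    sc = sc
SimpleClopen-blocks (suc j) sc = SimpleClopen-blocks j (SimpleClopen-block sc)

AgreeReal : ℕ → ℝ → ℝ → Set
AgreeReal l z w = ∀ t → t < l → z t ≡ w t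

ContinuousReal : (ℝ → ℝ) → Set
ContinuousReal f = ∀ z l → Σ ℕ λ l′ → ∀ w → AgreeReal l′ z w → AgreeReal l (f z) (f w)

Continuous : ∀ {n k} → (Tuple n → Tuple k) → Set
Continuous {n} e = ∀ x l → Σ ℕ λ l′ → ∀ (y : Tuple n) → Agree l′ x y → Agree l (e x) (e y)

Agree-mono : ∀ {n l l′} {x y : Tuple n} → l′ ≤ l → Agree l x y → Agree l′ x y
Agree-mono l′≤l agree i t t<l′ = agree i t (<-≤-trans t<l′ l′≤l)

Agree-sym : ∀ {n l} {x y : Tuple n} → Agree l x y → Agree l y x
Agree-sym agree i t t<l = sym (agree i t t<l)

Agree-snoc : ∀ {n l} {x x′ : Tuple n} {z z′ : ℝ} →
  Agree l x x′ → AgreeReal l z z′ → Agree l (snoc x z) (snoc x′ z′)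
Agree-snoc {zero}  _     agreeʳ zero    = agreeʳ
Agree-snoc {suc n} agree _      zero    = agree zero
Agree-snoc {suc n} agree agreeʳ (suc i) = Agree-snoc (agree ∘ suc) agreeʳ i

movesI-continuous : ContinuousReal movesI
movesI-continuous z l = l + l , λ w agree t t<l → agree (t + t) (+-mono-< t<l t<l)

movesII-continuous : ContinuousReal movesII
movesII-continuous z l = suc (l + l) , λ w agree t t<l →
  agree (suc (t + t)) (s≤s (+-mono-< t<l t<l))

snoc-continuous : ∀ {n k} {e : Tuple n → Tuple k} {f : ℝ → ℝ} →
  Continuous e → ContinuousReal f →
  Continuous (λ (r : Tuple (suc n)) → snoc (e (initT r)) (f (lastT r)))
snoc-continuous {n} e-cont f-cont r l
  with e-cont (initT r) l | f-cont (lastT r) l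
... | l₁ , e-agree | l₂ , f-agree = l₁ + l₂ , λ r′ agree →
  Agree-snoc (e-agree (initT r′) (λ i → Agree-mono (m≤m+n l₁ l₂) agree (inject₁ i)))
             (f-agree (lastT r′) (Agree-mono (m≤n+m l₂ l₁) agree (fromℕ n)))

DeterminedBy : ∀ {k} → ℕ → (Tuple k → Set) → Set
DeterminedBy l P = ∀ x y → Agree l x y → P x → P y

DeterminedBy-¬ : ∀ {k l} {P : Tuple k → Set} → DeterminedBy l P → DeterminedBy l (¬_ ∘ P)
DeterminedBy-¬ det x y agree ¬Px Py = ¬Px (det y x (Agree-sym agree) Py)

DeterminedBy-clopen : ∀ {n k l} {P : Tuple k → Set} {e : Tuple n → Tuple k} →
  DeterminedBy l P → Continuous e → IsClopen (P ∘ e)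
DeterminedBy-clopen {l = l} {e = e} det e-cont =
  open-preimage det , open-preimage (DeterminedBy-¬ det)
  where
  open-preimage : ∀ {Q} → DeterminedBy l Q → IsOpen (Q ∘ e)
  open-preimage detQ x Qex with e-cont x l
  ... | l′ , agree = l′ , λ y agreeXY → detQ (e x) (e y) (agree y agreeXY) Qex

Prefix-agree : ∀ s {z w : ℝ} → AgreeReal (length s) z w → Prefix s z → Prefix s w
Prefix-agree []      _     _              = _
Prefix-agree (a ∷ s) agree (z₀≡a , prefix) =
  trans (sym (agree 0 (s≤s z≤n))) z₀≡a ,
  Prefix-agree s (λ t t<len → agree (suc t) (s≤s t<len)) prefix

totalLength : ∀ {k} → (Fin k → List ℕ) → ℕ
totalLength {zero}  s = 0
totalLength {suc k} s = length (s zero) + totalLength (s ∘ suc)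

length≤totalLength : ∀ {k} (s : Fin k → List ℕ) i → length (s i) ≤ totalLength s
length≤totalLength {suc k} s zero    = m≤m+n _ _
length≤totalLength {suc k} s (suc i) = ≤-trans (length≤totalLength (s ∘ suc) i) (m≤n+m _ _)

basicOpen-determined : ∀ {k} (s : Fin k → List ℕ) →
  DeterminedBy (totalLength s) (λ x → ∀ i → Prefix (s i) (x i))
basicOpen-determined s x y agree prefixes i =
  Prefix-agree (s i) (Agree-mono (length≤totalLength s i) agree i) (prefixes i)

BasicSet-determined : ∀ {k} (B : BasicSet k) →
  DeterminedBy (totalLength (BasicSet.stems B)) ⟦ B ⟧b
BasicSet-determined (basicSet true  s) = basicOpen-determined s
BasicSet-determined (basicSet false s) = DeterminedBy-¬ (basicOpen-determined s)

decode-SimpleClopen : ∀ {k n} {c : Code k} → NoCompl c →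
  (e : Tuple n → Tuple k) → Continuous e → SimpleClopen (decode false c e)
decode-SimpleClopen (nc-basic B)   e e-cont =
  sc-clopen 0 _ (DeterminedBy-clopen (BasicSet-determined B) e-cont)
decode-SimpleClopen (nc-union _ h) e e-cont =
  sc-I 0 _ (λ j → decode-SimpleClopen (h j) e e-cont)
decode-SimpleClopen (nc-inter _ h) e e-cont =
  sc-II 0 _ (λ j → decode-SimpleClopen (h j) e e-cont)
decode-SimpleClopen (nc-proj _ h)  e e-cont =
  SimpleClopen-block (decode-SimpleClopen h _ (snoc-continuous e-cont movesI-continuous))
decode-SimpleClopen (nc-univ _ h)  e e-cont =
  SimpleClopen-block (decode-SimpleClopen h _ (snoc-continuous e-cont movesII-continuous))

cast-continuous : ∀ {m n} (m≡n : m ≡ n) → Continuous (λ (r : Tuple m) i → r (cast (sym m≡n) i))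
cast-continuous m≡n r l = l , λ r′ agree i → agree (cast (sym m≡n) i)

-- The decoding game depends only on the code.
lemma3p6 : (k : ℕ) → 1 ≤ k → (A : Tuple k → Set) → (c : Code k) →
    (∀ x → A x ⇔ ⟦ c ⟧ x) → NoCompl c →
    SimpleClopen (decodingGame c)
lemma3p6 k _ _ _ _ noCompl =
  SimpleClopen-blocks k (decode-SimpleClopen noCompl _ (cast-continuous (+-identityʳ k)))
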